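{- The following formulas are derivable in the proof system $\mathsf{MLSR}$, for all formulas $\varphi,\alpha,\varphi_1,\varphi_2,\psi$: (i) $\langle!\varphi\rangle\alpha\rightarrow\varphi$; (ii) $\langle-(\varphi_1\vee\varphi_2)\rangle\psi\leftrightarrow(\langle-\varphi_1\rangle\psi\vee\langle-\varphi_2\rangle\psi)$; (iii) $\mathsf{E}\alpha\leftrightarrow(\alpha\vee\langle-\alpha\rangle\top)$.
   Context: Fix countable sets $\mathsf{PROP}$ (proposition letters) and $\mathsf{NOM}$ (nominals). Formulas: $\varphi ::= p\mid \mathsf{n}\mid\top\mid\neg\varphi\mid(\varphi\vee\varphi)\mid\Diamond\varphi\mid\langle!\varphi\rangle\varphi\mid\langle-\varphi\rangle\varphi\mid\mathsf{E}\varphi$; $\Box,[!\varphi],[-\varphi],\mathsf{U}$ are the duals; $\wedge,\rightarrow,\leftrightarrow,\bot$ as usual. Proof system $\mathsf{MLSR}$: (1) Replacement of provable equivalents (inside any context, including modalities); (2) propositional tautologies and Modus Ponens; (3) K axiom and necessitation for each of $\Box$, $\mathsf{U}$, $[!\varphi]$, $[-\varphi]$; (4) S5 axioms for $\mathsf{U}$ and $\mathsf{U}\varphi\rightarrow\Box\varphi$; (5) $\langle!\varphi\rangle p\leftrightarrow(\varphi\wedge p)$, $\langle!\varphi\rangle\mathsf{n}\leftrightarrow(\varphi\wedge\mathsf{n})$, $\langle!\varphi\rangle\top\leftrightarrow\varphi$, $\langle!\varphi\rangle\neg\psi\leftrightarrow(\varphi\wedge\neg\langle!\varphi\rangle\psi)$,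 $\langle!\varphi\rangle(\psi\vee\alpha)\leftrightarrow(\langle!\varphi\rangle\psi\vee\langle!\varphi\rangle\alpha)$, $\langle!\varphi\rangle\Diamond\psi\leftrightarrow(\varphi\wedge\Diamond\langle!\varphi\rangle\psi)$, $\langle!\varphi\rangle\langle!\psi\rangle\alpha\leftrightarrow\langle!(\varphi\wedge[!\varphi]\psi)\rangle\alpha$, $\langle!\varphi\rangle\mathsf{E}\psi\leftrightarrow(\varphi\wedge\mathsf{E}\langle!\varphi\rangle\psi)$; (6) $\langle!\top\rangle\varphi\leftrightarrow\varphi$; (7) (H) $\mathsf{E}(\mathsf{n}\wedge\varphi)\rightarrow\mathsf{U}(\mathsf{n}\rightarrow\varphi)$; (8) Name rule: from $\mathsf{m}\rightarrow\varphi$ infer $\varphi$ if $\mathsf{m}$ not in $\varphi$; (9) Paste rule: for $\nabla\in\{\Diamond,\mathsf{E}\}$, from $(\mathsf{E}(\mathsf{n}\wedge\nabla\mathsf{m})\wedge\mathsf{E}(\mathsf{m}\wedge\varphi))\rightarrow\sigma$ infer $\mathsf{E}(\mathsf{n}\wedge\nabla\varphi)\rightarrow\sigma$ if $\mathsf{m}$ not in $\varphi,\sigma$; (10) Mix Axiom $(\mathsf{E}(\mathsf{n}\wedge\alpha)\wedge\langle!\neg\mathsf{n}\rangle\varphi)\rightarrow\langle-\alpha\rangle\varphi$; (11) Mix Rule: from $\mathsf{E}(\mathsf{n}\wedge\langle!\varphi\rangle(\mathsf{E}(\mathsf{k}\wedge\alpha)\wedge\langle!\neg\mathsf{k}\rangle\psi))\rightarrow\sigma$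 infer $\mathsf{E}(\mathsf{n}\wedge\langle!\varphi\rangle\langle-\alpha\rangle\psi)\rightarrow\sigma$ if $\mathsf{k}$ not in $\varphi,\alpha,\psi,\sigma$. -}

module Defs where

open import Data.Nat using (ℕ; _≡ᵇ_)
open import Data.Bool using (Bool; true; false; not; _∨_)
open import Relation.Binary.PropositionalEquality using (_≡_)

-- PROP and NOM are countable: both represented by ℕ.
Prop : Set
Prop = ℕ

Nom : Set
Nom = ℕ

infixr 30 ~_ ⟨!_⟩_ ⟨-_⟩_ [!_]_ [-_]_
infixl 25 _∨ᶠ_ _∧ᶠ_
infixr 20 _⇒_
infix 15 _⇔_

data Form : Set where
  prop  : Prop → Form
  nom   : Nom → Form
  ⊤ᶠ    : Form
  ~_    : Form → Form
  _∨ᶠ_  : Form → Form → Form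
  ◇     : Form → Form
  ⟨!_⟩_ : Form → Form → Form
  ⟨-_⟩_ : Form → Form → Form
  E     : Form → Form

_∧ᶠ_ : Form → Form → Form
φ ∧ᶠ ψ = ~ (~ φ ∨ᶠ ~ ψ)

_⇒_ : Form → Form → Form
φ ⇒ ψ = ~ φ ∨ᶠ ψ

_⇔_ : Form → Form → Form
φ ⇔ ψ = (φ ⇒ ψ) ∧ᶠ (ψ ⇒ φ)

⊥ᶠ : Form
⊥ᶠ = ~ ⊤ᶠ

□ : Form → Form
□ φ = ~ ◇ (~ φ)

[!_]_ : Form → Form → Form
[! φ ] ψ = ~ (⟨! φ ⟩ (~ ψ))

[-_]_ : Form → Form → Form
[- φ ] ψ = ~ (⟨- φ ⟩ (~ ψ))

U : Form → Form
U φ = ~ E (~ φ)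

occurs : Nom → Form → Bool
occurs m (prop p)    = false
occurs m (nom n)     = m ≡ᵇ n
occurs m ⊤ᶠ          = false
occurs m (~ φ)       = occurs m φ
occurs m (φ ∨ᶠ ψ)    = occurs m φ ∨ occurs m ψ
occurs m (◇ φ)       = occurs m φ
occurs m (⟨! φ ⟩ ψ)  = occurs m φ ∨ occurs m ψ
occurs m (⟨- φ ⟩ ψ)  = occurs m φ ∨ occurs m ψ
occurs m (E φ)       = occurs m φ

_∉_ : Nom → Form → Set
m ∉ φ = occurs m φ ≡ false

-- Propositional tautologies: formulas true under every Boolean valuation
-- that assigns arbitrary values to the propositionally atomic subformulas
-- (letters, nominals, and formulas headed by a modality).
eval : (Form → Bool) → Form → Bool
eval v (prop p)    = v (prop p)
eval v (nom n)     = v (nom n)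
eval v ⊤ᶠ          = true
eval v (~ φ)       = not (eval v φ)
eval v (φ ∨ᶠ ψ)    = eval v φ ∨ eval v ψ
eval v (◇ φ)       = v (◇ φ)
eval v (⟨! φ ⟩ ψ)  = v (⟨! φ ⟩ ψ)
eval v (⟨- φ ⟩ ψ)  = v (⟨- φ ⟩ ψ)
eval v (E φ)       = v (E φ)

Tautology : Form → Set
Tautology φ = ∀ (v : Form → Bool) → eval v φ ≡ true

data Ctx : Set where
  hole  : Ctx
  ~c    : Ctx → Ctx
  ∨l    : Ctx → Form → Ctx
  ∨r    : Form → Ctx → Ctx
  ◇c    : Ctx → Ctx
  !l    : Ctx → Form → Ctx
  !r    : Form → Ctx → Ctx
  -l    : Ctx → Form → Ctx
  -r    : Form → Ctx → Ctx
  Ec    : Ctx → Ctx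

plug : Ctx → Form → Form
plug hole     χ = χ
plug (~c C)   χ = ~ plug C χ
plug (∨l C ψ) χ = plug C χ ∨ᶠ ψ
plug (∨r φ C) χ = φ ∨ᶠ plug C χ
plug (◇c C)   χ = ◇ (plug C χ)
plug (!l C ψ) χ = ⟨! plug C χ ⟩ ψ
plug (!r φ C) χ = ⟨! φ ⟩ plug C χ
plug (-l C ψ) χ = ⟨- plug C χ ⟩ ψ
plug (-r φ C) χ = ⟨- φ ⟩ plug C χ
plug (Ec C)   χ = E (plug C χ)

data BoxOp : Set where
  boxB  : BoxOp
  boxU  : BoxOp
  boxAn : Form → BoxOp
  boxRm : Form → BoxOp

applyBox : BoxOp → Form → Form
applyBox boxB      φ = □ φ
applyBox boxU      φ = U φ
applyBox (boxAn χ) φ = [! χ ] φ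
applyBox (boxRm χ) φ = [- χ ] φ

data PasteOp : Set where
  pDia : PasteOp
  pE   : PasteOp

applyP : PasteOp → Form → Form
applyP pDia φ = ◇ φ
applyP pE   φ = E φ

infix 5 ⊢_
data ⊢_ : Form → Set where
  repl   : ∀ {α β} (C : Ctx) → ⊢ (α ⇔ β) → ⊢ (plug C α ⇔ plug C β)
  taut   : ∀ {φ} → Tautology φ → ⊢ φ
  mp     : ∀ {φ ψ} → ⊢ (φ ⇒ ψ) → ⊢ φ → ⊢ ψ
  axK    : ∀ (b : BoxOp) φ ψ →
           ⊢ (applyBox b (φ ⇒ ψ) ⇒ (applyBox b φ ⇒ applyBox b ψ))
  nec    : ∀ (b : BoxOp) {φ} → ⊢ φ → ⊢ applyBox b φ
  axT    : ∀ φ → ⊢ (U φ ⇒ φ)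
  ax4    : ∀ φ → ⊢ (U φ ⇒ U (U φ))
  ax5    : ∀ φ → ⊢ (~ U φ ⇒ U (~ U φ))
  axU□   : ∀ φ → ⊢ (U φ ⇒ □ φ)
  r!p    : ∀ φ p → ⊢ (⟨! φ ⟩ prop p ⇔ (φ ∧ᶠ prop p))
  r!n    : ∀ φ n → ⊢ (⟨! φ ⟩ nom n ⇔ (φ ∧ᶠ nom n))
  r!⊤    : ∀ φ → ⊢ (⟨! φ ⟩ ⊤ᶠ ⇔ φ)
  r!¬    : ∀ φ ψ → ⊢ (⟨! φ ⟩ (~ ψ) ⇔ (φ ∧ᶠ ~ (⟨! φ ⟩ ψ)))
  r!∨    : ∀ φ ψ α → ⊢ (⟨! φ ⟩ (ψ ∨ᶠ α) ⇔ (⟨! φ ⟩ ψ ∨ᶠ ⟨! φ ⟩ α))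
  r!◇    : ∀ φ ψ → ⊢ (⟨! φ ⟩ ◇ ψ ⇔ (φ ∧ᶠ ◇ (⟨! φ ⟩ ψ)))
  r!!    : ∀ φ ψ α → ⊢ (⟨! φ ⟩ (⟨! ψ ⟩ α) ⇔ ⟨! (φ ∧ᶠ [! φ ] ψ) ⟩ α)
  r!E    : ∀ φ ψ → ⊢ (⟨! φ ⟩ E ψ ⇔ (φ ∧ᶠ E (⟨! φ ⟩ ψ)))
  ax!⊤   : ∀ φ → ⊢ (⟨! ⊤ᶠ ⟩ φ ⇔ φ)
  axH    : ∀ n φ → ⊢ (E (nom n ∧ᶠ φ) ⇒ U (nom n ⇒ φ))
  name   : ∀ {m φ} → m ∉ φ → ⊢ (nom m ⇒ φ) → ⊢ φ
  paste  : ∀ (d : PasteOp) {n m φ σ} → m ∉ φ → m ∉ σ →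
           ⊢ ((E (nom n ∧ᶠ applyP d (nom m)) ∧ᶠ E (nom m ∧ᶠ φ)) ⇒ σ) →
           ⊢ (E (nom n ∧ᶠ applyP d φ) ⇒ σ)
  mixAx  : ∀ n α φ → ⊢ ((E (nom n ∧ᶠ α) ∧ᶠ ⟨! ~ nom n ⟩ φ) ⇒ ⟨- α ⟩ φ)
  mixR   : ∀ {n k φ α ψ σ} → k ∉ φ → k ∉ α → k ∉ ψ → k ∉ σ →
           ⊢ (E (nom n ∧ᶠ ⟨! φ ⟩ (E (nom k ∧ᶠ α) ∧ᶠ ⟨! ~ nom k ⟩ ψ)) ⇒ σ) →
           ⊢ (E (nom n ∧ᶠ ⟨! φ ⟩ ⟨- α ⟩ ψ) ⇒ σ)

-- (i) ⟨!φ⟩α implies ⟨!φ⟩⊤, which the reduction axioms identify with φ.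
-- (ii) and (iii) rest on the derived rule mix-elim: to derive ⟨-α⟩ψ → σ it suffices to derive
-- (E(k ∧ α) ∧ ⟨!¬k⟩ψ) → σ for a fresh nominal k; together with the Mix axiom this makes ⟨-α⟩ψ
-- behave like "some α-world k is removed and ψ holds afterwards". Then (ii) is distribution of E
-- over ∨, and for (iii) one names an α-world m by the Paste rule: either we are at m, so α holds
-- by (H), or ¬m holds, and the Mix axiom applied to ⟨!¬m⟩⊤ yields ⟨-α⟩⊤.
module Submission where

open import Defs
open import Data.Bool using (Bool; true; false; not; _∨_; _∧_; T)
open import Data.Bool.Properties using (T-∧; T-≡)
open import Data.List using (List; []; _∷_; map; length; foldr)
open import Data.List.Properties using (length-map)
open import Data.List.Relation.Unary.All using (All; []; _∷_)
open import Data.Nat using (ℕ; zero; suc; _≤_; _<_; _⊔_; _≡ᵇ_; s≤s)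
open import Data.Nat.Properties using (≤-refl; ≤-trans; m≤m⊔n; m≤n⊔m)
open import Data.Product using (_×_; _,_)
open import Function using (_∘_)
open import Function.Bundles using (Equivalence)
open import Relation.Binary.PropositionalEquality using (_≡_; refl; cong; cong₂; trans)

-- Schemas are formulas over ⊤ᶠ, ~ and ∨ᶠ whose letters prop i act as metavariables.
-- Nominals and modal formulas never occur in a schema, so they are sent to ⊤ᶠ arbitrarily.
lookupOr : {X : Set} → X → List X → ℕ → X
lookupOr d []       i       = d
lookupOr d (x ∷ xs) zero    = x
lookupOr d (x ∷ xs) (suc i) = lookupOr d xs i

instantiate : List Form → Form → Form
instantiate Γ (prop i)   = lookupOr ⊤ᶠ Γ i
instantiate Γ (nom n)    = ⊤ᶠ
instantiate Γ ⊤ᶠ         = ⊤ᶠ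
instantiate Γ (~ F)      = ~ instantiate Γ F
instantiate Γ (F ∨ᶠ G)   = instantiate Γ F ∨ᶠ instantiate Γ G
instantiate Γ (◇ F)      = ⊤ᶠ
instantiate Γ (⟨! F ⟩ G) = ⊤ᶠ
instantiate Γ (⟨- F ⟩ G) = ⊤ᶠ
instantiate Γ (E F)      = ⊤ᶠ

evalSchema : List Bool → Form → Bool
evalSchema bs (prop i)   = lookupOr true bs i
evalSchema bs (nom n)    = true
evalSchema bs ⊤ᶠ         = true
evalSchema bs (~ F)      = not (evalSchema bs F)
evalSchema bs (F ∨ᶠ G)   = evalSchema bs F ∨ evalSchema bs G
evalSchema bs (◇ F)      = true
evalSchema bs (⟨! F ⟩ G) = true
evalSchema bs (⟨- F ⟩ G) = true
evalSchema bs (E F)      = true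

eval-lookupOr : ∀ v Γ i → eval v (lookupOr ⊤ᶠ Γ i) ≡ lookupOr true (map (eval v) Γ) i
eval-lookupOr v []      i       = refl
eval-lookupOr v (φ ∷ Γ) zero    = refl
eval-lookupOr v (φ ∷ Γ) (suc i) = eval-lookupOr v Γ i

eval-instantiate : ∀ v Γ F → eval v (instantiate Γ F) ≡ evalSchema (map (eval v) Γ) F
eval-instantiate v Γ (prop i)   = eval-lookupOr v Γ i
eval-instantiate v Γ (nom n)    = refl
eval-instantiate v Γ ⊤ᶠ         = refl
eval-instantiate v Γ (~ F)      = cong not (eval-instantiate v Γ F)
eval-instantiate v Γ (F ∨ᶠ G)   = cong₂ _∨_ (eval-instantiate v Γ F) (eval-instantiate v Γ G)
eval-instantiate v Γ (◇ F)      = refl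
eval-instantiate v Γ (⟨! F ⟩ G) = refl
eval-instantiate v Γ (⟨- F ⟩ G) = refl
eval-instantiate v Γ (E F)      = refl

allValuations : ℕ → (List Bool → Bool) → Bool
allValuations zero    f = f []
allValuations (suc n) f = allValuations n (f ∘ (true ∷_)) ∧ allValuations n (f ∘ (false ∷_))

allValuations-sound : ∀ n f → T (allValuations n f) → ∀ bs → length bs ≡ n → T (f bs)
allValuations-sound zero    f h []           refl = h
allValuations-sound (suc n) f h (true ∷ bs)  refl with Equivalence.to T-∧ h
... | h₁ , _ = allValuations-sound n _ h₁ bs refl
allValuations-sound (suc n) f h (false ∷ bs) refl with Equivalence.to T-∧ h
... | _ , h₂ = allValuations-sound n _ h₂ bs refl

tautology : (F : Form) (Γ : List Form) →
            T (allValuations (length Γ) (λ bs → evalSchema bs F)) → ⊢ instantiate Γ F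
tautology F Γ h = taut λ v → trans (eval-instantiate v Γ F)
  (Equivalence.to T-≡ (allValuations-sound (length Γ) _ h (map (eval v) Γ) (length-map (eval v) Γ)))

x₀ x₁ x₂ x₃ x₄ : Form
x₀ = prop 0
x₁ = prop 1
x₂ = prop 2
x₃ = prop 3
x₄ = prop 4

⇒-trans : ∀ {A B C} → ⊢ (A ⇒ B) → ⊢ (B ⇒ C) → ⊢ (A ⇒ C)
⇒-trans {A} {B} {C} h₁ h₂ = mp (mp (tautology ((x₀ ⇒ x₁) ⇒ (x₁ ⇒ x₂) ⇒ x₀ ⇒ x₂) (A ∷ B ∷ C ∷ []) _) h₁) h₂

⇔-to : ∀ {A B} → ⊢ (A ⇔ B) → ⊢ (A ⇒ B)
⇔-to {A} {B} = mp (tautology ((x₀ ⇔ x₁) ⇒ x₀ ⇒ x₁) (A ∷ B ∷ []) _)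

⇔-from : ∀ {A B} → ⊢ (A ⇔ B) → ⊢ (B ⇒ A)
⇔-from {A} {B} = mp (tautology ((x₀ ⇔ x₁) ⇒ x₁ ⇒ x₀) (A ∷ B ∷ []) _)

⇔-intro : ∀ {A B} → ⊢ (A ⇒ B) → ⊢ (B ⇒ A) → ⊢ (A ⇔ B)
⇔-intro {A} {B} h₁ h₂ = mp (mp (tautology ((x₀ ⇒ x₁) ⇒ (x₁ ⇒ x₀) ⇒ (x₀ ⇔ x₁)) (A ∷ B ∷ []) _) h₁) h₂

contraposition : ∀ {A B} → ⊢ (A ⇒ B) → ⊢ (~ B ⇒ ~ A)
contraposition {A} {B} = mp (tautology ((x₀ ⇒ x₁) ⇒ ~ x₁ ⇒ ~ x₀) (A ∷ B ∷ []) _)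

⇒-curry : ∀ {A B C} → ⊢ ((A ∧ᶠ B) ⇒ C) → ⊢ (A ⇒ B ⇒ C)
⇒-curry {A} {B} {C} = mp (tautology (((x₀ ∧ᶠ x₁) ⇒ x₂) ⇒ x₀ ⇒ x₁ ⇒ x₂) (A ∷ B ∷ C ∷ []) _)

⇒-monoʳ : ∀ {A B C} → ⊢ (A ⇒ B) → ⊢ ((C ⇒ A) ⇒ C ⇒ B)
⇒-monoʳ {A} {B} {C} = mp (tautology ((x₀ ⇒ x₁) ⇒ (x₂ ⇒ x₀) ⇒ x₂ ⇒ x₁) (A ∷ B ∷ C ∷ []) _)

⊤-intro : ∀ {A} → ⊢ (A ⇒ ⊤ᶠ)
⊤-intro {A} = tautology (x₀ ⇒ ⊤ᶠ) (A ∷ []) _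

~~-intro : ∀ {A} → ⊢ (A ⇒ ~ ~ A)
~~-intro {A} = tautology (x₀ ⇒ ~ ~ x₀) (A ∷ []) _

~~-elim : ∀ {A} → ⊢ (~ ~ A ⇒ A)
~~-elim {A} = tautology (~ ~ x₀ ⇒ x₀) (A ∷ []) _

∧-elimˡ : ∀ {A B} → ⊢ ((A ∧ᶠ B) ⇒ A)
∧-elimˡ {A} {B} = tautology ((x₀ ∧ᶠ x₁) ⇒ x₀) (A ∷ B ∷ []) _

∧-elimʳ : ∀ {A B} → ⊢ ((A ∧ᶠ B) ⇒ B)
∧-elimʳ {A} {B} = tautology ((x₀ ∧ᶠ x₁) ⇒ x₁) (A ∷ B ∷ []) _

∧-monoˡ : ∀ {A B C} → ⊢ (A ⇒ B) → ⊢ ((A ∧ᶠ C) ⇒ (B ∧ᶠ C))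
∧-monoˡ {A} {B} {C} = mp (tautology ((x₀ ⇒ x₁) ⇒ (x₀ ∧ᶠ x₂) ⇒ (x₁ ∧ᶠ x₂)) (A ∷ B ∷ C ∷ []) _)

∧-monoʳ : ∀ {A B C} → ⊢ (A ⇒ B) → ⊢ ((C ∧ᶠ A) ⇒ (C ∧ᶠ B))
∧-monoʳ {A} {B} {C} = mp (tautology ((x₀ ⇒ x₁) ⇒ (x₂ ∧ᶠ x₀) ⇒ (x₂ ∧ᶠ x₁)) (A ∷ B ∷ C ∷ []) _)

∨-introˡ : ∀ {A B} → ⊢ (A ⇒ (A ∨ᶠ B))
∨-introˡ {A} {B} = tautology (x₀ ⇒ (x₀ ∨ᶠ x₁)) (A ∷ B ∷ []) _

∨-introʳ : ∀ {A B} → ⊢ (B ⇒ (A ∨ᶠ B))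
∨-introʳ {A} {B} = tautology (x₁ ⇒ (x₀ ∨ᶠ x₁)) (A ∷ B ∷ []) _

∨-elim : ∀ {A B C} → ⊢ (A ⇒ C) → ⊢ (B ⇒ C) → ⊢ ((A ∨ᶠ B) ⇒ C)
∨-elim {A} {B} {C} h₁ h₂ = mp (mp (tautology ((x₀ ⇒ x₂) ⇒ (x₁ ⇒ x₂) ⇒ (x₀ ∨ᶠ x₁) ⇒ x₂) (A ∷ B ∷ C ∷ []) _) h₁) h₂

∨-map : ∀ {A B C D} → ⊢ (A ⇒ C) → ⊢ (B ⇒ D) → ⊢ ((A ∨ᶠ B) ⇒ (C ∨ᶠ D))
∨-map {A} {B} {C} {D} h₁ h₂ =
  mp (mp (tautology ((x₀ ⇒ x₂) ⇒ (x₁ ⇒ x₃) ⇒ (x₀ ∨ᶠ x₁) ⇒ (x₂ ∨ᶠ x₃)) (A ∷ B ∷ C ∷ D ∷ []) _) h₁) h₂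

∧-distribˡ-∨ : ∀ {A B C} → ⊢ ((A ∧ᶠ (B ∨ᶠ C)) ⇒ ((A ∧ᶠ B) ∨ᶠ (A ∧ᶠ C)))
∧-distribˡ-∨ {A} {B} {C} = tautology ((x₀ ∧ᶠ (x₁ ∨ᶠ x₂)) ⇒ ((x₀ ∧ᶠ x₁) ∨ᶠ (x₀ ∧ᶠ x₂))) (A ∷ B ∷ C ∷ []) _

∧-distribʳ-∨ : ∀ {A B C} → ⊢ (((A ∨ᶠ B) ∧ᶠ C) ⇒ ((A ∧ᶠ C) ∨ᶠ (B ∧ᶠ C)))
∧-distribʳ-∨ {A} {B} {C} = tautology (((x₀ ∨ᶠ x₁) ∧ᶠ x₂) ⇒ ((x₀ ∧ᶠ x₂) ∨ᶠ (x₁ ∧ᶠ x₂))) (A ∷ B ∷ C ∷ []) _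

□-mono : ∀ b {A B} → ⊢ (A ⇒ B) → ⊢ (applyBox b A ⇒ applyBox b B)
□-mono b {A} {B} h = mp (axK b A B) (nec b h)

◇-mono : ∀ b {A B} → ⊢ (A ⇒ B) → ⊢ (~ applyBox b (~ A) ⇒ ~ applyBox b (~ B))
◇-mono b h = contraposition (□-mono b (contraposition h))

plug-~~ : ∀ C A → ⊢ (plug C A ⇔ ~ ~ plug C (~ ~ A))
plug-~~ C A = ⇔-intro (⇒-trans (⇔-to (repl C (dne A))) ~~-intro)
                      (⇒-trans ~~-elim (⇔-from (repl C (dne A))))
  where
  dne : ∀ A → ⊢ (A ⇔ ~ ~ A)
  dne A = tautology (x₀ ⇔ ~ ~ x₀) (A ∷ []) _

-- ⟨!φ⟩ and E are the diamonds of [!φ] and U only up to the double negations in ~ ~ ⟨!φ⟩ ~ ~ A.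
mono-via-dual : ∀ C {A B} → ⊢ (~ ~ plug C (~ ~ A) ⇒ ~ ~ plug C (~ ~ B)) → ⊢ (plug C A ⇒ plug C B)
mono-via-dual C h = ⇒-trans (⇔-to (plug-~~ C _)) (⇒-trans h (⇔-from (plug-~~ C _)))

⟨!⟩-mono : ∀ φ {A B} → ⊢ (A ⇒ B) → ⊢ (⟨! φ ⟩ A ⇒ ⟨! φ ⟩ B)
⟨!⟩-mono φ h = mono-via-dual (!r φ hole) (◇-mono (boxAn φ) h)

E-mono : ∀ {A B} → ⊢ (A ⇒ B) → ⊢ (E A ⇒ E B)
E-mono h = mono-via-dual (Ec hole) (◇-mono boxU h)

E-intro : ∀ {A} → ⊢ (A ⇒ E A)
E-intro {A} = ⇒-trans (mp (tautology ((~ x₀ ⇒ ~ x₁) ⇒ x₁ ⇒ x₀) (E (~ ~ A) ∷ A ∷ []) _) (axT (~ A)))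
                      (E-mono ~~-elim)

E-∨ : ∀ {A B} → ⊢ (E (A ∨ᶠ B) ⇒ (E A ∨ᶠ E B))
E-∨ {A} {B} = ⇒-trans (E-mono ~~-intro) (⇒-trans dual (∨-map (E-mono ~~-elim) (E-mono ~~-elim)))
  where
  U-∧ : ⊢ (U (~ A) ⇒ U (~ B) ⇒ U (~ (A ∨ᶠ B)))
  U-∧ = ⇒-trans (□-mono boxU (tautology (~ x₀ ⇒ ~ x₁ ⇒ ~ (x₀ ∨ᶠ x₁)) (A ∷ B ∷ []) _))
                (axK boxU (~ B) (~ (A ∨ᶠ B)))
  dual : ⊢ (E (~ ~ (A ∨ᶠ B)) ⇒ (E (~ ~ A) ∨ᶠ E (~ ~ B)))
  dual = mp (tautology ((~ x₀ ⇒ ~ x₁ ⇒ ~ x₂) ⇒ x₂ ⇒ (x₀ ∨ᶠ x₁))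
                       (E (~ ~ A) ∷ E (~ ~ B) ∷ E (~ ~ (A ∨ᶠ B)) ∷ []) _) U-∧

bound : Form → ℕ
bound (prop p)   = 0
bound (nom n)    = suc n
bound ⊤ᶠ         = 0
bound (~ φ)      = bound φ
bound (φ ∨ᶠ ψ)   = bound φ ⊔ bound ψ
bound (◇ φ)      = bound φ
bound (⟨! φ ⟩ ψ) = bound φ ⊔ bound ψ
bound (⟨- φ ⟩ ψ) = bound φ ⊔ bound ψ
bound (E φ)      = bound φ

∨-false : ∀ {a b} → a ≡ false → b ≡ false → a ∨ b ≡ false
∨-false refl refl = refl

<⇒≡ᵇ-false : ∀ {m n} → n < m → (m ≡ᵇ n) ≡ false
<⇒≡ᵇ-false {suc m} {zero}  _         = refl
<⇒≡ᵇ-false {suc m} {suc n} (s≤s n<m) = <⇒≡ᵇ-false n<m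

bound≤⇒∉ : ∀ φ {m} → bound φ ≤ m → m ∉ φ
bound≤⇒∉ (prop p)   h = refl
bound≤⇒∉ (nom n)    h = <⇒≡ᵇ-false h
bound≤⇒∉ ⊤ᶠ         h = refl
bound≤⇒∉ (~ φ)      h = bound≤⇒∉ φ h
bound≤⇒∉ (φ ∨ᶠ ψ)   h = ∨-false (bound≤⇒∉ φ (≤-trans (m≤m⊔n _ _) h)) (bound≤⇒∉ ψ (≤-trans (m≤n⊔m _ _) h))
bound≤⇒∉ (◇ φ)      h = bound≤⇒∉ φ h
bound≤⇒∉ (⟨! φ ⟩ ψ) h = ∨-false (bound≤⇒∉ φ (≤-trans (m≤m⊔n _ _) h)) (bound≤⇒∉ ψ (≤-trans (m≤n⊔m _ _) h))
bound≤⇒∉ (⟨- φ ⟩ ψ) h = ∨-false (bound≤⇒∉ φ (≤-trans (m≤m⊔n _ _) h)) (bound≤⇒∉ ψ (≤-trans (m≤n⊔m _ _) h))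
bound≤⇒∉ (E φ)      h = bound≤⇒∉ φ h

fresh : List Form → Nom
fresh = foldr (λ φ m → bound φ ⊔ m) 0

fresh≤⇒∉ : ∀ Γ {m} → fresh Γ ≤ m → All (m ∉_) Γ
fresh≤⇒∉ []      h = []
fresh≤⇒∉ (φ ∷ Γ) h = bound≤⇒∉ φ (≤-trans (m≤m⊔n _ _) h) ∷ fresh≤⇒∉ Γ (≤-trans (m≤n⊔m (bound φ) _) h)

fresh-∉ : ∀ Γ → All (fresh Γ ∉_) Γ
fresh-∉ Γ = fresh≤⇒∉ Γ ≤-refl

E-elim : ∀ {α σ} → (∀ m → ⊢ (E (nom m ∧ᶠ α) ⇒ σ)) → ⊢ (E α ⇒ σ)
E-elim {α} {σ} h with fresh (α ∷ σ ∷ []) | fresh-∉ (α ∷ σ ∷ [])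
... | m | mα ∷ mσ ∷ [] = name (∨-false mα mσ) (⇒-curry (⇒-trans E-intro pasted))
  where
  pasted : ⊢ (E (nom m ∧ᶠ E α) ⇒ σ)
  pasted = paste pE mα mσ (⇒-trans ∧-elimʳ (h m))

-- The Mix rule removes ⟨-α⟩ only under ⟨!φ⟩ at a named world; we take φ = ⊤ and name the current
-- world n, and (H) with the T axiom turns the hypothesis into the premise the Mix rule asks for.
mix-elim : ∀ {α ψ σ} → (∀ k → ⊢ ((E (nom k ∧ᶠ α) ∧ᶠ ⟨! ~ nom k ⟩ ψ) ⇒ σ)) → ⊢ (⟨- α ⟩ ψ ⇒ σ)
mix-elim {α} {ψ} {σ} h with fresh (α ∷ ψ ∷ σ ∷ []) | fresh-∉ (α ∷ ψ ∷ σ ∷ [])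
... | n | nα ∷ nψ ∷ nσ ∷ [] with fresh (α ∷ ψ ∷ σ ∷ nom n ∷ []) | fresh-∉ (α ∷ ψ ∷ σ ∷ nom n ∷ [])
... | k | kα ∷ kψ ∷ kσ ∷ kn ∷ [] = name (∨-false (∨-false nα nψ) nσ) (⇒-curry (absorb atCurrent))
  where
  θ = ⟨- α ⟩ ψ
  atNamed : ⊢ (E (nom n ∧ᶠ ⟨! ⊤ᶠ ⟩ θ) ⇒ nom n ⇒ σ)
  atNamed = mixR refl kα kψ (∨-false kn kσ)
    (⇒-trans (axH n _) (⇒-trans (axT _) (⇒-monoʳ (⇒-trans (⇔-to (ax!⊤ _)) (h k)))))
  atCurrent : ⊢ ((nom n ∧ᶠ θ) ⇒ nom n ⇒ σ)
  atCurrent = ⇒-trans (∧-monoʳ (⇔-from (ax!⊤ θ))) (⇒-trans E-intro atNamed)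
  absorb : ⊢ ((nom n ∧ᶠ θ) ⇒ nom n ⇒ σ) → ⊢ ((nom n ∧ᶠ θ) ⇒ σ)
  absorb = mp (tautology (((x₀ ∧ᶠ x₁) ⇒ x₀ ⇒ x₂) ⇒ (x₀ ∧ᶠ x₁) ⇒ x₂) (nom n ∷ θ ∷ σ ∷ []) _)

⟨!⟩-precondition : ∀ φ α → ⊢ (⟨! φ ⟩ α ⇒ φ)
⟨!⟩-precondition φ α = ⇒-trans (⟨!⟩-mono φ ⊤-intro) (⇔-to (r!⊤ φ))

⟨-⟩-monoˡ : ∀ {φ φ′} ψ → ⊢ (φ ⇒ φ′) → ⊢ (⟨- φ ⟩ ψ ⇒ ⟨- φ′ ⟩ ψ)
⟨-⟩-monoˡ {φ′ = φ′} ψ h = mix-elim λ k → ⇒-trans (∧-monoˡ (E-mono (∧-monoʳ h))) (mixAx k φ′ ψ)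

⟨-⟩-∨ : ∀ φ₁ φ₂ ψ → ⊢ (⟨- (φ₁ ∨ᶠ φ₂) ⟩ ψ ⇔ (⟨- φ₁ ⟩ ψ ∨ᶠ ⟨- φ₂ ⟩ ψ))
⟨-⟩-∨ φ₁ φ₂ ψ = ⇔-intro
  (mix-elim λ k → ⇒-trans (∧-monoˡ (⇒-trans (E-mono ∧-distribˡ-∨) E-∨))
                 (⇒-trans ∧-distribʳ-∨ (∨-map (mixAx k φ₁ ψ) (mixAx k φ₂ ψ))))
  (∨-elim (⟨-⟩-monoˡ ψ ∨-introˡ) (⟨-⟩-monoˡ ψ ∨-introʳ))

E⇔here-or-removable : ∀ α → ⊢ (E α ⇔ (α ∨ᶠ ⟨- α ⟩ ⊤ᶠ))
E⇔here-or-removable α = ⇔-intro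
  (E-elim λ m → mp (mp (mp (tautology ((x₀ ⇒ x₁ ⇒ x₂) ⇒ ((x₀ ∧ᶠ x₃) ⇒ x₄) ⇒ (~ x₁ ⇒ x₃) ⇒ x₀ ⇒ (x₂ ∨ᶠ x₄))
                                        (E (nom m ∧ᶠ α) ∷ nom m ∷ α ∷ ⟨! ~ nom m ⟩ ⊤ᶠ ∷ ⟨- α ⟩ ⊤ᶠ ∷ []) _)
                              (⇒-trans (axH m α) (axT _)))
                         (mixAx m α ⊤ᶠ))
                    (⇔-from (r!⊤ (~ nom m))))
  (∨-elim E-intro (mix-elim λ k → ⇒-trans ∧-elimˡ (E-mono ∧-elimʳ)))

mainTheorem9 : (∀ φ α → ⊢ (⟨! φ ⟩ α ⇒ φ))
    × (∀ φ₁ φ₂ ψ → ⊢ (⟨- (φ₁ ∨ᶠ φ₂) ⟩ ψ ⇔ (⟨- φ₁ ⟩ ψ ∨ᶠ ⟨- φ₂ ⟩ ψ)))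
    × (∀ α → ⊢ (E α ⇔ (α ∨ᶠ ⟨- α ⟩ ⊤ᶠ)))
mainTheorem9 = ⟨!⟩-precondition , ⟨-⟩-∨ , E⇔here-or-removable
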